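{- For every odd prime $p$ and every $L\ge 0$, \[a_{\mathrm{carry}}(L)=p^L\,a_{\mathrm{dbl}}(L).\] For $p=2$ this scaling law fails.
   Context: Fix a base $p\ge 2$. Carry in addition: for a pair of digit strings $(a_1,\dots,a_L),(b_1,\dots,b_L)\in\{0,\dots,p-1\}^L$ (least significant digit first), set $\sigma_0=0$ and $\sigma_j=\lfloor (a_j+b_j+\sigma_{j-1})/p\rfloor$. The pair is cascade-free if there is no $j$ with $a_j+b_j=p-1$ and $\sigma_{j-1}=1$; $a_{\mathrm{carry}}(L)$ is the number of cascade-free pairs (out of $p^{2L}$). Carry in doubling: for a digit string $(d_1,\dots,d_L)\in\{0,\dots,p-1\}^L$ (the base-$p$ digits of $m\in[0,p^L)$), set $\sigma_0=0$, $\sigma_j=\lfloor(2d_j+\sigma_{j-1})/p\rfloor$; it is cascade-free if there is no $j$ with $2d_j=p-1$ and $\sigma_{j-1}=1$; $a_{\mathrm{dbl}}(L)$ is the number of cascade-free strings. -}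

module Defs where

open import Data.Nat using (ℕ; zero; suc; _+_; _*_; _≡ᵇ_; NonZero)
open import Data.Nat.DivMod using (_/_)
open import Data.Bool using (Bool; true; false; _∧_; not)
open import Data.Fin using (Fin; toℕ)
open import Data.Vec using (Vec; []; _∷_)
open import Data.List using (List; []; _∷_; concatMap; map; length; filter; allFin)
open import Data.Product using (_×_; _,_)
open import Relation.Nullary.Decidable using (Dec; yes; no)
open import Data.Bool.Properties using (T?)

-- Digit strings are Vec (Fin p) L, least significant digit first (head = d_1).

allStrings : (p L : ℕ) → List (Vec (Fin p) L)
allStrings p zero = [] ∷ []
allStrings p (suc L) = concatMap (λ d → map (d ∷_) (allStrings p L)) (allFin p)

-- Addition: cascade-free check, given incoming carry σ_{j-1}.
-- A cascade at position j: a_j + b_j = p - 1 and σ_{j-1} = 1,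
-- i.e. a_j + b_j + 1 = p with σ_{j-1} = 1.
cfAddFrom : (p : ℕ) .{{_ : NonZero p}} → {L : ℕ} → ℕ → Vec (Fin p) L → Vec (Fin p) L → Bool
cfAddFrom p σ [] [] = true
cfAddFrom p σ (a ∷ as) (b ∷ bs) =
  not ((σ ≡ᵇ 1) ∧ ((toℕ a + toℕ b + 1) ≡ᵇ p))
  ∧ cfAddFrom p ((toℕ a + toℕ b + σ) / p) as bs

cascadeFreeAdd : (p : ℕ) .{{_ : NonZero p}} → {L : ℕ} → Vec (Fin p) L → Vec (Fin p) L → Bool
cascadeFreeAdd p = cfAddFrom p 0

cfDblFrom : (p : ℕ) .{{_ : NonZero p}} → {L : ℕ} → ℕ → Vec (Fin p) L → Bool
cfDblFrom p σ [] = true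
cfDblFrom p σ (d ∷ ds) =
  not ((σ ≡ᵇ 1) ∧ ((2 * toℕ d + 1) ≡ᵇ p))
  ∧ cfDblFrom p ((2 * toℕ d + σ) / p) ds

cascadeFreeDbl : (p : ℕ) .{{_ : NonZero p}} → {L : ℕ} → Vec (Fin p) L → Bool
cascadeFreeDbl p = cfDblFrom p 0

countTrue : {A : Set} → (A → Bool) → List A → ℕ
countTrue f [] = 0
countTrue f (x ∷ xs) with f x
... | true = suc (countTrue f xs)
... | false = countTrue f xs

aCarry : (p : ℕ) .{{_ : NonZero p}} → ℕ → ℕ
aCarry p L = countTrue (λ ab → cascadeFreeAdd p (Data.Product.proj₁ ab) (Data.Product.proj₂ ab))
  (concatMap (λ a → map (a ,_) (allStrings p L)) (allStrings p L))

aDbl : (p : ℕ) .{{_ : NonZero p}} → ℕ → ℕ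
aDbl p L = countTrue (cascadeFreeDbl p) (allStrings p L)

-- Split off the lowest digit and keep track of the incoming carry σ ∈ {0, 1}.  Let u_σ(L) count
-- the cascade-free pairs and v_σ(L) the cascade-free doubling strings entered with carry σ.
-- Against a lowest digit d of the first summand, exactly p − d − σ digits e of the second give no
-- outgoing carry and d give carry 1 (for σ = 1 the remaining e is the cascade), so, with
-- T(n) = 0 + 1 + ⋯ + (n − 1),
--   u₀(L+1) = T(p+1) u₀(L) + T(p) u₁(L),    u₁(L+1) = T(p) u₀(L) + T(p) u₁(L).
-- For p = 2k + 1 a digit d doubles without carry iff d ≤ k (σ = 0), resp. d < k (σ = 1), so
--   v₀(L+1) = (k+1) v₀(L) + k v₁(L),        v₁(L+1) = k v₀(L) + k v₁(L).
-- As T(p) = pk and T(p+1) = p(k+1), the first recurrence is p times the second.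
{-# OPTIONS --safe #-}
module Submission where

open import Defs
open import Data.Nat using (ℕ; _^_; _*_; _%_)
open import Data.Nat.Primality using (Prime; prime⇒nonZero)
open import Data.Product using (_×_; ∃)
open import Relation.Binary.PropositionalEquality using (_≡_; _≢_)

open import Function using (_∘_; id)
open import Data.Bool using (Bool; true; false; _∧_; not; if_then_else_)
open import Data.Nat using (zero; suc; _+_; _∸_; _<_; _≡ᵇ_; _≟_; NonZero; s≤s; z≤n)
open import Data.Nat.Properties
  using ( +-assoc; +-comm; +-suc; +-identityʳ; *-suc; *-zeroʳ; *-identityˡ; *-distribˡ-+; *-cancelˡ-≡
        ; m≤m+n; m+n∸m≡n; m∸n+n≡m; m+[n∸m]≡n; n∸n≡0; m+1+n≢m
        ; <⇒≤; <⇒≢; <-trans; ≤-<-trans; +-monoʳ-<; +-mono-<; +-mono-≤ )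
open import Data.Nat.DivMod using (_/_; m<n⇒m/n≡0; m/n≡1+[m∸n]/n; m≡m%n+[m/n]*n)
open import Data.Nat.Tactic.RingSolver using (solve-∀)
open import Data.Nat.ListAction using (sum)
open import Data.Nat.ListAction.Properties using (sum-++)
open import Data.Fin using (Fin; toℕ)
open import Data.Fin.Properties using (toℕ<n)
open import Data.Vec using (Vec; _∷_)
open import Data.List using (List; []; _∷_; _++_; concatMap; map; tabulate; allFin)
open import Data.List.Properties using (map-cong; map-tabulate; map-++; map-∘)
open import Data.Product using (_,_; proj₁; proj₂)
open import Relation.Nullary.Decidable using (dec-true; dec-false)
open import Relation.Binary.PropositionalEquality using (refl; sym; trans; cong; cong₂; subst; module ≡-Reasoning)

open ≡-Reasoning

countTrue-++ : ∀ {A : Set} (f : A → Bool) xs ys →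
               countTrue f (xs ++ ys) ≡ countTrue f xs + countTrue f ys
countTrue-++ f []       ys = refl
countTrue-++ f (x ∷ xs) ys with f x
... | true  = cong suc (countTrue-++ f xs ys)
... | false = countTrue-++ f xs ys

countTrue-map : ∀ {A B : Set} (f : B → Bool) (g : A → B) xs →
                countTrue f (map g xs) ≡ countTrue (f ∘ g) xs
countTrue-map f g []       = refl
countTrue-map f g (x ∷ xs) with f (g x)
... | true  = cong suc (countTrue-map f g xs)
... | false = countTrue-map f g xs

countTrue-concatMap : ∀ {A B : Set} (f : B → Bool) (g : A → List B) xs →
                      countTrue f (concatMap g xs) ≡ sum (map (countTrue f ∘ g) xs)
countTrue-concatMap f g []       = refl
countTrue-concatMap f g (x ∷ xs) =
  trans (countTrue-++ f (g x) (concatMap g xs)) (cong (countTrue f (g x) +_) (countTrue-concatMap f g xs))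

countTrue-const∧ : ∀ {A : Set} b (f : A → Bool) xs →
                   countTrue (λ x → b ∧ f x) xs ≡ (if b then countTrue f xs else 0)
countTrue-const∧ true  f xs       = refl
countTrue-const∧ false f []       = refl
countTrue-const∧ false f (x ∷ xs) = countTrue-const∧ false f xs

sum-map-concatMap : ∀ {A B : Set} (h : B → ℕ) (g : A → List B) xs →
                    sum (map h (concatMap g xs)) ≡ sum (map (sum ∘ map h ∘ g) xs)
sum-map-concatMap h g []       = refl
sum-map-concatMap h g (x ∷ xs) = begin
  sum (map h (g x ++ concatMap g xs))               ≡⟨ cong sum (map-++ h (g x) (concatMap g xs)) ⟩
  sum (map h (g x) ++ map h (concatMap g xs))       ≡⟨ sum-++ (map h (g x)) (map h (concatMap g xs)) ⟩
  sum (map h (g x)) + sum (map h (concatMap g xs))  ≡⟨ cong (sum (map h (g x)) +_) (sum-map-concatMap h g xs) ⟩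
  sum (map h (g x)) + sum (map (sum ∘ map h ∘ g) xs) ∎

sum-map-linear : ∀ {A : Set} a b (f g : A → ℕ) xs →
                 sum (map (λ x → a * f x + b * g x) xs) ≡ a * sum (map f xs) + b * sum (map g xs)
sum-map-linear a b f g []       = sym (cong₂ _+_ (*-zeroʳ a) (*-zeroʳ b))
sum-map-linear a b f g (x ∷ xs) =
  trans (cong (a * f x + b * g x +_) (sum-map-linear a b f g xs)) (regroup a b (f x) (g x) _ _)
  where
  regroup : ∀ a b u v U V → a * u + b * v + (a * U + b * V) ≡ a * (u + U) + b * (v + V)
  regroup = solve-∀

Σ< : ℕ → (ℕ → ℕ) → ℕ
Σ< zero    h = 0
Σ< (suc n) h = h 0 + Σ< n (h ∘ suc)

sum-map-allFin : ∀ n (h : ℕ → ℕ) → sum (map (h ∘ toℕ) (allFin n)) ≡ Σ< n h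
sum-map-allFin n h = trans (cong sum (map-tabulate {n = n} id (h ∘ toℕ))) (sum-tabulate n h)
  where
  sum-tabulate : ∀ n (h : ℕ → ℕ) → sum (tabulate {n = n} (h ∘ toℕ)) ≡ Σ< n h
  sum-tabulate zero    h = refl
  sum-tabulate (suc n) h = cong (h 0 +_) (sum-tabulate n (h ∘ suc))

Σ<-split : ∀ m n h → Σ< (m + n) h ≡ Σ< m h + Σ< n (λ i → h (m + i))
Σ<-split zero    n h = refl
Σ<-split (suc m) n h = trans (cong (h 0 +_) (Σ<-split m n (h ∘ suc))) (sym (+-assoc (h 0) _ _))

Σ<-const : ∀ n {h c} → (∀ i → i < n → h i ≡ c) → Σ< n h ≡ n * c
Σ<-const zero    h≡c = refl
Σ<-const (suc n) h≡c = cong₂ _+_ (h≡c 0 (s≤s z≤n)) (Σ<-const n (λ i i<n → h≡c (suc i) (s≤s i<n)))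

Σ<-piecewise : ∀ m n {h x y} → (∀ i → i < m → h i ≡ x) → (∀ i → i < n → h (m + i) ≡ y) →
               Σ< (m + n) h ≡ m * x + n * y
Σ<-piecewise m n below above = trans (Σ<-split m n _) (cong₂ _+_ (Σ<-const m below) (Σ<-const n above))

Σ<-piecewise-gap : ∀ m n {h x y} → (∀ i → i < m → h i ≡ x) → h m ≡ 0 →
                   (∀ i → i < n → h (m + suc i) ≡ y) → Σ< (m + suc n) h ≡ m * x + n * y
Σ<-piecewise-gap m n {h} below gap above = begin
  Σ< (m + suc n) h                                      ≡⟨ Σ<-split m (suc n) h ⟩
  Σ< m h + (h (m + 0) + Σ< n (λ i → h (m + suc i)))     ≡⟨ cong (λ z → Σ< m h + (h z + Σ< n (λ i → h (m + suc i)))) (+-identityʳ m) ⟩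
  Σ< m h + (h m + Σ< n (λ i → h (m + suc i)))           ≡⟨ cong₂ _+_ (Σ<-const m below) (cong₂ _+_ gap (Σ<-const n above)) ⟩
  m * _ + n * _                                         ∎

Σ<-linear : ∀ n (f g : ℕ → ℕ) X Y → Σ< n (λ i → f i * X + g i * Y) ≡ Σ< n f * X + Σ< n g * Y
Σ<-linear zero    f g X Y = refl
Σ<-linear (suc n) f g X Y =
  trans (cong (f 0 * X + g 0 * Y +_) (Σ<-linear n (f ∘ suc) (g ∘ suc) X Y)) (regroup (f 0) (g 0) _ _ X Y)
  where
  regroup : ∀ a b A B X Y → a * X + b * Y + (A * X + B * Y) ≡ (a + A) * X + (b + B) * Y
  regroup = solve-∀

Σ<-last : ∀ n h → Σ< (suc n) h ≡ Σ< n h + h n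
Σ<-last zero    h = +-comm (h 0) 0
Σ<-last (suc n) h = trans (cong (h 0 +_) (Σ<-last n (h ∘ suc))) (sym (+-assoc (h 0) _ _))

Σ<-reverse : ∀ n h → Σ< n (λ i → h (n ∸ suc i)) ≡ Σ< n h
Σ<-reverse zero    h = refl
Σ<-reverse (suc n) h = begin
  h n + Σ< n (λ i → h (n ∸ suc i))  ≡⟨ cong (h n +_) (Σ<-reverse n h) ⟩
  h n + Σ< n h                      ≡⟨ +-comm (h n) _ ⟩
  Σ< n h + h n                      ≡⟨ Σ<-last n h ⟨
  Σ< (suc n) h                      ∎

tri : ℕ → ℕ
tri n = Σ< n id

Σ<[n∸i]≡tri[1+n] : ∀ n → Σ< n (n ∸_) ≡ tri (suc n)
Σ<[n∸i]≡tri[1+n] n = begin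
  Σ< n (n ∸_)                ≡⟨ +-identityʳ _ ⟨
  Σ< n (n ∸_) + 0            ≡⟨ cong (Σ< n (n ∸_) +_) (n∸n≡0 n) ⟨
  Σ< n (n ∸_) + (n ∸ n)      ≡⟨ Σ<-last n (n ∸_) ⟨
  Σ< (suc n) (n ∸_)          ≡⟨ Σ<-reverse (suc n) id ⟩
  tri (suc n)                ∎

2*tri[1+n]≡n*[1+n] : ∀ n → 2 * tri (suc n) ≡ n * suc n
2*tri[1+n]≡n*[1+n] zero    = refl
2*tri[1+n]≡n*[1+n] (suc n) = begin
  2 * tri (suc (suc n))              ≡⟨ cong (2 *_) (Σ<-last (suc n) id) ⟩
  2 * (tri (suc n) + suc n)          ≡⟨ *-distribˡ-+ 2 (tri (suc n)) (suc n) ⟩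
  2 * tri (suc n) + 2 * suc n        ≡⟨ cong (_+ 2 * suc n) (2*tri[1+n]≡n*[1+n] n) ⟩
  n * suc n + 2 * suc n              ≡⟨ regroup n ⟩
  suc n * suc (suc n)                ∎
  where
  regroup : ∀ n → n * suc n + 2 * suc n ≡ suc n * suc (suc n)
  regroup = solve-∀

tri-odd : ∀ k → tri (suc (k + k)) ≡ suc (k + k) * k
tri-odd k = *-cancelˡ-≡ _ _ 2 (trans (2*tri[1+n]≡n*[1+n] (k + k)) (regroup k))
  where
  regroup : ∀ k → (k + k) * suc (k + k) ≡ 2 * (suc (k + k) * k)
  regroup = solve-∀

tri-odd-suc : ∀ k → tri (suc (suc (k + k))) ≡ suc (k + k) * suc k
tri-odd-suc k = begin
  tri (suc (suc (k + k)))            ≡⟨ Σ<-last (suc (k + k)) id ⟩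
  tri (suc (k + k)) + suc (k + k)    ≡⟨ cong (_+ suc (k + k)) (tri-odd k) ⟩
  suc (k + k) * k + suc (k + k)      ≡⟨ +-comm _ (suc (k + k)) ⟩
  suc (k + k) + suc (k + k) * k      ≡⟨ *-suc (suc (k + k)) k ⟨
  suc (k + k) * suc k                ∎

x≡n+m⇒x/n≡1 : ∀ {x n m} .{{_ : NonZero n}} → x ≡ n + m → m < n → x / n ≡ 1
x≡n+m⇒x/n≡1 {n = n} {m} refl m<n = begin
  (n + m) / n            ≡⟨ m/n≡1+[m∸n]/n (m≤m+n n m) ⟩
  1 + (n + m ∸ n) / n    ≡⟨ cong (λ z → 1 + z / n) (m+n∸m≡n n m) ⟩
  1 + m / n              ≡⟨ cong (1 +_) (m<n⇒m/n≡0 m<n) ⟩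
  1                      ∎

-- A column entered with carry 1 whose sum, carry included, is x: the cascade of the paper
-- (a_j + b_j = p - 1, resp. 2 d_j = p - 1) is exactly x = n, and contributes nothing.
carryIn₁ : (n : ℕ) .{{_ : NonZero n}} → (ℕ → ℕ) → ℕ → ℕ
carryIn₁ n F x = if not (x ≡ᵇ n) then F (x / n) else 0

module _ {n : ℕ} .{{_ : NonZero n}} (F : ℕ → ℕ) where

  private
    carryIn₁-≡ᵇ : ∀ {x b} → (x ≡ᵇ n) ≡ b → carryIn₁ n F x ≡ (if not b then F (x / n) else 0)
    carryIn₁-≡ᵇ {x} = cong (λ b → if not b then F (x / n) else 0)

  carryIn₁-below : ∀ {x} → x < n → carryIn₁ n F x ≡ F 0
  carryIn₁-below {x} x<n = trans (carryIn₁-≡ᵇ (dec-false (x ≟ n) (<⇒≢ x<n))) (cong F (m<n⇒m/n≡0 x<n))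

  carryIn₁-cascade : ∀ {x} → x ≡ n → carryIn₁ n F x ≡ 0
  carryIn₁-cascade {x} x≡n = carryIn₁-≡ᵇ (dec-true (x ≟ n) x≡n)

  carryIn₁-above : ∀ {x m} → x ≡ n + suc m → suc m < n → carryIn₁ n F x ≡ F 1
  carryIn₁-above {x} x≡n+1+m 1+m<n =
    trans (carryIn₁-≡ᵇ (dec-false (x ≟ n) x≢n)) (cong F (x≡n+m⇒x/n≡1 x≡n+1+m 1+m<n))
    where
    x≢n : x ≢ n
    x≢n x≡n = m+1+n≢m n (trans (sym x≡n+1+m) x≡n)

module _ (p : ℕ) .{{_ : NonZero p}} where

  -- The `+ 0` (here and in doubling-sum₀) is the incoming carry σ = 0, kept so that the
  -- summand is literally the one produced by the digit recursion.
  carry-sum₀ : ∀ {d} (F : ℕ → ℕ) → d < p →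
               Σ< p (λ e → F ((d + e + 0) / p)) ≡ (p ∸ d) * F 0 + d * F 1
  carry-sum₀ {d} F d<p = trans (cong (λ n → Σ< n h) (sym (m∸n+n≡m (<⇒≤ d<p)))) (Σ<-piecewise q d below above)
    where
    q = p ∸ d
    d+q≡p : d + q ≡ p
    d+q≡p = m+[n∸m]≡n (<⇒≤ d<p)
    h : ℕ → ℕ
    h e = F ((d + e + 0) / p)
    below : ∀ e → e < q → h e ≡ F 0
    below e e<q = cong F (m<n⇒m/n≡0 (subst (_< p) (sym (+-identityʳ (d + e))) d+e<p))
      where
      d+e<p : d + e < p
      d+e<p = subst (d + e <_) d+q≡p (+-monoʳ-< d e<q)
    above : ∀ i → i < d → h (q + i) ≡ F 1
    above i i<d = cong F (x≡n+m⇒x/n≡1 (trans (regroup d q i) (cong (_+ i) d+q≡p)) (<-trans i<d d<p))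
      where
      regroup : ∀ d q i → d + (q + i) + 0 ≡ d + q + i
      regroup = solve-∀

  carry-sum₁ : ∀ {d} (F : ℕ → ℕ) → d < p →
               Σ< p (λ e → carryIn₁ p F (d + e + 1)) ≡ (p ∸ suc d) * F 0 + d * F 1
  carry-sum₁ {d} F d<p = trans (cong (λ n → Σ< n h) (sym (m∸n+n≡m d<p))) (Σ<-piecewise-gap q d below cascade above)
    where
    q = p ∸ suc d
    1+d+q≡p : suc d + q ≡ p
    1+d+q≡p = m+[n∸m]≡n d<p
    h : ℕ → ℕ
    h e = carryIn₁ p F (d + e + 1)
    below : ∀ e → e < q → h e ≡ F 0
    below e e<q = carryIn₁-below F (subst (_< p) (sym (+-comm (d + e) 1)) 1+d+e<p)
      where
      1+d+e<p : suc d + e < p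
      1+d+e<p = subst (suc d + e <_) 1+d+q≡p (+-monoʳ-< (suc d) e<q)
    cascade : h q ≡ 0
    cascade = carryIn₁-cascade F (trans (+-comm (d + q) 1) 1+d+q≡p)
    above : ∀ i → i < d → h (q + suc i) ≡ F 1
    above i i<d = carryIn₁-above F (trans (regroup d q (suc i)) (cong (_+ suc i) 1+d+q≡p)) (≤-<-trans i<d d<p)
      where
      regroup : ∀ d q i → d + (q + i) + 1 ≡ suc d + q + i
      regroup = solve-∀

module _ (k : ℕ) where
  private
    P : ℕ
    P = suc (k + k)

  doubling-sum₀ : (F : ℕ → ℕ) → Σ< P (λ d → F ((2 * d + 0) / P)) ≡ suc k * F 0 + k * F 1
  doubling-sum₀ F = Σ<-piecewise (suc k) k below above
    where
    double : ∀ d → d + d ≡ 2 * d + 0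
    double = solve-∀
    below : ∀ d → d < suc k → F ((2 * d + 0) / P) ≡ F 0
    below d (s≤s d≤k) = cong F (m<n⇒m/n≡0 (subst (_< P) (double d) (s≤s (+-mono-≤ d≤k d≤k))))
    regroup : ∀ k i → 2 * (suc k + i) + 0 ≡ suc (k + k) + suc (i + i)
    regroup = solve-∀
    above : ∀ i → i < k → F ((2 * (suc k + i) + 0) / P) ≡ F 1
    above i i<k = cong F (x≡n+m⇒x/n≡1 (regroup k i) (s≤s (+-mono-< i<k i<k)))

  doubling-sum₁ : (F : ℕ → ℕ) → Σ< P (λ d → carryIn₁ P F (2 * d + 1)) ≡ k * F 0 + k * F 1
  doubling-sum₁ F = trans (cong (λ n → Σ< n h) (sym (+-suc k k))) (Σ<-piecewise-gap k k below cascade above)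
    where
    h : ℕ → ℕ
    h d = carryIn₁ P F (2 * d + 1)
    double : ∀ d → suc (d + d) ≡ 2 * d + 1
    double = solve-∀
    below : ∀ d → d < k → h d ≡ F 0
    below d d<k = carryIn₁-below F (subst (_< P) (double d) (s≤s (+-mono-< d<k d<k)))
    cascade : h k ≡ 0
    cascade = carryIn₁-cascade F (sym (double k))
    regroup : ∀ k i → 2 * (k + suc i) + 1 ≡ suc (k + k) + suc (i + suc i)
    regroup = solve-∀
    above : ∀ i → i < k → h (k + suc i) ≡ F 1
    above i i<k = carryIn₁-above F (regroup k i) (s≤s (+-mono-≤ i<k i<k))

module Counts (p : ℕ) .{{_ : NonZero p}} where

  countTrue-allStrings-suc : ∀ {L} (P : Vec (Fin p) (suc L) → Bool) (g : ℕ → ℕ) →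
                             (∀ d → countTrue (P ∘ (d ∷_)) (allStrings p L) ≡ g (toℕ d)) →
                             countTrue P (allStrings p (suc L)) ≡ Σ< p g
  countTrue-allStrings-suc {L} P g column = begin
    countTrue P (allStrings p (suc L))                                     ≡⟨ countTrue-concatMap P _ (allFin p) ⟩
    sum (map (λ d → countTrue P (map (d ∷_) (allStrings p L))) (allFin p))  ≡⟨ cong sum (map-cong column′ (allFin p)) ⟩
    sum (map (g ∘ toℕ) (allFin p))                                         ≡⟨ sum-map-allFin p g ⟩
    Σ< p g                                                                 ∎
    where
    column′ : ∀ d → countTrue P (map (d ∷_) (allStrings p L)) ≡ g (toℕ d)
    column′ d = trans (countTrue-map P (d ∷_) (allStrings p L)) (column d)

  sum-allStrings-suc : ∀ {L} (h : Vec (Fin p) (suc L) → ℕ) (g : ℕ → ℕ) →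
                       (∀ d → sum (map (h ∘ (d ∷_)) (allStrings p L)) ≡ g (toℕ d)) →
                       sum (map h (allStrings p (suc L))) ≡ Σ< p g
  sum-allStrings-suc {L} h g column = begin
    sum (map h (allStrings p (suc L)))                                   ≡⟨ sum-map-concatMap h _ (allFin p) ⟩
    sum (map (λ d → sum (map h (map (d ∷_) (allStrings p L)))) (allFin p)) ≡⟨ cong sum (map-cong column′ (allFin p)) ⟩
    sum (map (g ∘ toℕ) (allFin p))                                       ≡⟨ sum-map-allFin p g ⟩
    Σ< p g                                                               ∎
    where
    column′ : ∀ d → sum (map h (map (d ∷_) (allStrings p L))) ≡ g (toℕ d)
    column′ d = trans (cong sum (sym (map-∘ (allStrings p L)))) (column d)

  doublings : ℕ → ℕ → ℕ
  doublings σ L = countTrue (cfDblFrom p σ) (allStrings p L)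

  partners : ℕ → ∀ {L} → Vec (Fin p) L → ℕ
  partners σ {L} a = countTrue (cfAddFrom p σ a) (allStrings p L)

  pairs : ℕ → ℕ → ℕ
  pairs σ L = sum (map (partners σ) (allStrings p L))

  aCarry≡pairs : ∀ L → aCarry p L ≡ pairs 0 L
  aCarry≡pairs L = trans (countTrue-concatMap _ _ (allStrings p L))
                         (cong sum (map-cong (λ a → countTrue-map _ (a ,_) (allStrings p L)) (allStrings p L)))

  doublings-suc : ∀ σ L → doublings σ (suc L) ≡
                  Σ< p (λ d → if not ((σ ≡ᵇ 1) ∧ (2 * d + 1 ≡ᵇ p)) then doublings ((2 * d + σ) / p) L else 0)
  doublings-suc σ L = countTrue-allStrings-suc (cfDblFrom p σ) _
    (λ d → countTrue-const∧ _ (cfDblFrom p ((2 * toℕ d + σ) / p)) (allStrings p L))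

  partners-suc : ∀ σ {L} d (a : Vec (Fin p) L) → partners σ (d ∷ a) ≡
                 Σ< p (λ e → if not ((σ ≡ᵇ 1) ∧ (toℕ d + e + 1 ≡ᵇ p)) then partners ((toℕ d + e + σ) / p) a else 0)
  partners-suc σ {L} d a = countTrue-allStrings-suc (cfAddFrom p σ (d ∷ a)) _
    (λ e → countTrue-const∧ _ (cfAddFrom p ((toℕ d + toℕ e + σ) / p) a) (allStrings p L))

  pairs-suc : ∀ σ L (c : ℕ → ℕ) →
              (∀ d (a : Vec (Fin p) L) → partners σ (d ∷ a) ≡ c (toℕ d) * partners 0 a + toℕ d * partners 1 a) →
              pairs σ (suc L) ≡ Σ< p c * pairs 0 L + tri p * pairs 1 L
  pairs-suc σ L c partners-digit = trans (sum-allStrings-suc (partners σ) _ row) (Σ<-linear p c id (pairs 0 L) (pairs 1 L))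
    where
    row : ∀ d → sum (map (partners σ ∘ (d ∷_)) (allStrings p L)) ≡ c (toℕ d) * pairs 0 L + toℕ d * pairs 1 L
    row d = trans (cong sum (map-cong (partners-digit d) (allStrings p L)))
                  (sum-map-linear (c (toℕ d)) (toℕ d) (partners 0) (partners 1) (allStrings p L))

  pairs-suc₀ : ∀ L → pairs 0 (suc L) ≡ tri (suc p) * pairs 0 L + tri p * pairs 1 L
  pairs-suc₀ L = trans (pairs-suc 0 L (p ∸_) (λ d a → trans (partners-suc 0 d a) (carry-sum₀ p (λ τ → partners τ a) (toℕ<n d))))
                       (cong (λ c → c * pairs 0 L + tri p * pairs 1 L) (Σ<[n∸i]≡tri[1+n] p))

  pairs-suc₁ : ∀ L → pairs 1 (suc L) ≡ tri p * pairs 0 L + tri p * pairs 1 L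
  pairs-suc₁ L = trans (pairs-suc 1 L (λ d → p ∸ suc d) (λ d a → trans (partners-suc 1 d a) (carry-sum₁ p (λ τ → partners τ a) (toℕ<n d))))
                       (cong (λ c → c * pairs 0 L + tri p * pairs 1 L) (Σ<-reverse p id))

scaled-recurrence : ∀ p a₀ b₀ a₁ b₁ {u₀ u₁ v₀ v₁ : ℕ → ℕ} →
                    (∀ L → u₀ (suc L) ≡ p * a₀ * u₀ L + p * b₀ * u₁ L) →
                    (∀ L → u₁ (suc L) ≡ p * a₁ * u₀ L + p * b₁ * u₁ L) →
                    (∀ L → v₀ (suc L) ≡ a₀ * v₀ L + b₀ * v₁ L) →
                    (∀ L → v₁ (suc L) ≡ a₁ * v₀ L + b₁ * v₁ L) →
                    u₀ 0 ≡ v₀ 0 → u₁ 0 ≡ v₁ 0 →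
                    ∀ L → u₀ L ≡ p ^ L * v₀ L × u₁ L ≡ p ^ L * v₁ L
scaled-recurrence p a₀ b₀ a₁ b₁ u₀-suc u₁-suc v₀-suc v₁-suc u₀≡v₀ u₁≡v₁ zero =
  trans u₀≡v₀ (sym (*-identityˡ _)) , trans u₁≡v₁ (sym (*-identityˡ _))
scaled-recurrence p a₀ b₀ a₁ b₁ {u₀} {u₁} {v₀} {v₁} u₀-suc u₁-suc v₀-suc v₁-suc u₀≡v₀ u₁≡v₁ (suc L) =
  step (u₀-suc L) (v₀-suc L) , step (u₁-suc L) (v₁-suc L)
  where
  ih = scaled-recurrence p a₀ b₀ a₁ b₁ u₀-suc u₁-suc v₀-suc v₁-suc u₀≡v₀ u₁≡v₁ L
  regroup : ∀ p q a b x y → p * a * (q * x) + p * b * (q * y) ≡ p * q * (a * x + b * y)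
  regroup = solve-∀
  step : ∀ {a b u v} → u ≡ p * a * u₀ L + p * b * u₁ L → v ≡ a * v₀ L + b * v₁ L → u ≡ p ^ suc L * v
  step {a} {b} {u} {v} u-rec v-rec = begin
    u                                                 ≡⟨ u-rec ⟩
    p * a * u₀ L + p * b * u₁ L                       ≡⟨ cong₂ (λ x y → p * a * x + p * b * y) (proj₁ ih) (proj₂ ih) ⟩
    p * a * (p ^ L * v₀ L) + p * b * (p ^ L * v₁ L)   ≡⟨ regroup p (p ^ L) a b (v₀ L) (v₁ L) ⟩
    p ^ suc L * (a * v₀ L + b * v₁ L)                 ≡⟨ cong (p ^ suc L *_) v-rec ⟨
    p ^ suc L * v                                     ∎

aCarry≡p^L*aDbl : ∀ {p} .{{_ : NonZero p}} k → p ≡ suc (k + k) → ∀ L → aCarry p L ≡ p ^ L * aDbl p L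
aCarry≡p^L*aDbl k refl L =
  trans (aCarry≡pairs L) (proj₁ (scaled-recurrence P (suc k) k k k pairs₀-odd pairs₁-odd doublings₀-odd doublings₁-odd refl refl L))
  where
  P = suc (k + k)
  open Counts P
  pairs₀-odd : ∀ L → pairs 0 (suc L) ≡ P * suc k * pairs 0 L + P * k * pairs 1 L
  pairs₀-odd L = trans (pairs-suc₀ L) (cong₂ (λ a b → a * pairs 0 L + b * pairs 1 L) (tri-odd-suc k) (tri-odd k))
  pairs₁-odd : ∀ L → pairs 1 (suc L) ≡ P * k * pairs 0 L + P * k * pairs 1 L
  pairs₁-odd L = trans (pairs-suc₁ L) (cong₂ (λ a b → a * pairs 0 L + b * pairs 1 L) (tri-odd k) (tri-odd k))
  doublings₀-odd : ∀ L → doublings 0 (suc L) ≡ suc k * doublings 0 L + k * doublings 1 L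
  doublings₀-odd L = trans (doublings-suc 0 L) (doubling-sum₀ k (λ τ → doublings τ L))
  doublings₁-odd : ∀ L → doublings 1 (suc L) ≡ k * doublings 0 L + k * doublings 1 L
  doublings₁-odd L = trans (doublings-suc 1 L) (doubling-sum₁ k (λ τ → doublings τ L))

m%2≡1⇒m≡1+[m/2+m/2] : ∀ m → m % 2 ≡ 1 → m ≡ suc (m / 2 + m / 2)
m%2≡1⇒m≡1+[m/2+m/2] m m%2≡1 = begin
  m                      ≡⟨ m≡m%n+[m/n]*n m 2 ⟩
  m % 2 + m / 2 * 2      ≡⟨ cong (_+ m / 2 * 2) m%2≡1 ⟩
  suc (m / 2 * 2)        ≡⟨ cong suc (double (m / 2)) ⟩
  suc (m / 2 + m / 2)    ∎
  where
  double : ∀ n → n * 2 ≡ n + n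
  double = solve-∀

theorem5p2 : ((p : ℕ) → (pp : Prime p) → p % 2 ≡ 1 → (L : ℕ) → aCarry p {{prime⇒nonZero pp}} L ≡ p ^ L * aDbl p {{prime⇒nonZero pp}} L)
    × ∃ λ L → aCarry 2 L ≢ 2 ^ L * aDbl 2 L
-- Primality is needed only for p ≠ 0.  For p = 2, L = 2: a_carry = 14 but 2² · a_dbl = 16.
theorem5p2 =
    (λ p pp p-odd → aCarry≡p^L*aDbl {{prime⇒nonZero pp}} (p / 2) (m%2≡1⇒m≡1+[m/2+m/2] p p-odd))
  , (2 , λ ())
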